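{- Let $f$ be an $s$-term DNF with a fixed representation, let $K$ be a positive integer, and let $h:\{0,1\}^n\to\{0,1\}$ be a DNF consisting of $k$ terms of $f$ that all lie in the same cluster $C$ of $\mathrm{Clustering}(f,K)$. Then $h$ is a $(k,\mu)$-factored-DNF for $\mu=16s^2K$.
   Context: Terms are conjunctions of literals, viewed as sets of literals; no term contains both $x_i$ and $\overline{x_i}$; the width of a term is its number of literals. Fix a total (lexicographic) order on terms. The $K$-clustering $\mathrm{Clustering}(f,K)$ is produced by the following deterministic procedure on the set $L$ of terms of $f$: while $L\neq\emptyset$, pick the first term $T$ (in the fixed order) among the terms of $L$ of minimum width, remove it from $L$, and create a cluster $C=\{T\}$ with label $T^*=T$, $S^*=\emptyset$; then, while there exists $T'\in L$ with $|\{\ell\in T': \ell\notin T^*\cup S^*\}|\le 2K$, pick the first such $T'$, remove it from $L$, add it to $C$, and update simultaneously $T^*\leftarrow T^*\cap T'$ and $S^*\leftarrow S^*\cup\{\ell,\overline{\ell}:\ell\in T^*\triangle T'\}$ (with $T^*$ the value before the update); when no such $T'$ exists, the cluster $C$ with its current label is finished. The output is the collection of clusters. A function $h:\{0,1\}^n\to\{0,1\}$ is an $(r,\mu)$-factored-DNF if $h=H\wedge(T_1\vee\cdots\vee T_{r'})$ for some $r'\le r$, where $H$ is a term of arbitrary width (the head), $T_1,\dots,T_{r'}$ are terms (the tail), the variables of $H$ are disjoint from the variables appearing in the tail, and the total number of variables appearing in the tail is at most $\mu$. -}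

module Defs where

open import Data.Bool using (Bool; true; false; _∧_; _∨_; not; if_then_else_)
open import Data.Maybe using (Maybe; just; nothing)
open import Data.Nat using (ℕ; zero; suc; _+_; _≤ᵇ_; _≡ᵇ_; _⊔_)
open import Data.Fin using (Fin)
open import Data.Vec using (Vec; []; _∷_; lookup; zipWith; replicate; tabulate)
open import Data.List using (List; []; _∷_; _++_; length)
open import Data.Bool.ListAction using (any)
open import Data.Product using (_×_; _,_)
open import Relation.Binary.PropositionalEquality using (_≡_)

-- A term over n variables: for each variable i, 'nothing' = variable absent,
-- 'just b' = literal x_i (b = true) or its negation (b = false).
-- Viewed as a set of literals; it can never contain both x_i and ¬x_i.
Term : ℕ → Set
Term n = Vec (Maybe Bool) n

-- A set S* of literals closed under complementation = a set of variables.
VarSet : ℕ → Set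
VarSet n = Vec Bool n

isJust : ∀ {A : Set} → Maybe A → Bool
isJust (just _) = true
isJust nothing  = false

countTrue : ∀ {n} → Vec Bool n → ℕ
countTrue []            = 0
countTrue (true  ∷ bs) = suc (countTrue bs)
countTrue (false ∷ bs) = countTrue bs

eqB : Bool → Bool → Bool
eqB true true = true
eqB false false = true
eqB _ _ = false

eqM : Maybe Bool → Maybe Bool → Bool
eqM nothing nothing = true
eqM (just a) (just b) = eqB a b
eqM _ _ = false

width : ∀ {n} → Term n → ℕ
width T = countTrue (Data.Vec.map isJust T)

_∩ᵗ_ : ∀ {n} → Term n → Term n → Term n
T ∩ᵗ T' = zipWith (λ a b → if eqM a b then a else nothing) T T'

symDiffVars : ∀ {n} → Term n → Term n → VarSet n
symDiffVars T T' = zipWith (λ a b → not (eqM a b)) T T'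

_∪ᵛ_ : ∀ {n} → VarSet n → VarSet n → VarSet n
_∪ᵛ_ = zipWith _∨_

newLits : ∀ {n} → Term n → VarSet n → Term n → ℕ
newLits Tst Sst T' = countTrue (tabulate λ i →
  isJust (lookup T' i) ∧ not (eqM (lookup T' i) (lookup Tst i)) ∧ not (lookup Sst i))

extractFirst : ∀ {A : Set} → (A → Bool) → List A → Maybe (A × List A)
extractFirst p [] = nothing
extractFirst p (x ∷ xs) with p x
... | true  = just (x , xs)
... | false with extractFirst p xs
...   | nothing        = nothing
...   | just (y , ys) = just (y , x ∷ ys)

minWidth : ∀ {n} → List (Term n) → ℕ
minWidth []       = 0
minWidth (T ∷ []) = width T
minWidth (T ∷ Ts@(_ ∷ _)) = Data.Nat._⊓_ (width T) (minWidth Ts)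

-- inner loop: grow a cluster C with label (T*, S*) from the remaining list L;
-- returns the finished cluster and the remaining terms. (Fuel = |L| suffices.)
grow : ∀ {n} → ℕ → ℕ → List (Term n) → Term n → VarSet n → List (Term n)
     → List (Term n) × List (Term n)
grow K zero C Tst Sst L = C , L
grow K (suc fuel) C Tst Sst L with extractFirst (λ T' → newLits Tst Sst T' ≤ᵇ (2 Data.Nat.* K)) L
... | nothing        = C , L
... | just (T' , L') = grow K fuel (C ++ (T' ∷ [])) (Tst ∩ᵗ T') (Sst ∪ᵛ symDiffVars Tst T') L'

-- outer loop (fuel = |L| suffices since each step removes a term)
clusterLoop : ∀ {n} → ℕ → ℕ → List (Term n) → List (List (Term n))
clusterLoop K zero L = []
clusterLoop K (suc fuel) L with extractFirst (λ T → width T ≡ᵇ minWidth L) L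
... | nothing       = []
... | just (T , L') with grow K (length L') (T ∷ []) T (replicate _ false) L'
...   | (C , L'') = C ∷ clusterLoop K fuel L''

-- Clustering(f, K): the fixed total order on terms is the order of the list f.
Clustering : ∀ {n} → List (Term n) → ℕ → List (List (Term n))
Clustering f K = clusterLoop K (length f) f

evalTerm : ∀ {n} → Term n → (Fin n → Bool) → Bool
evalTerm T x = Data.Vec.foldr _ _∧_ true (tabulate λ i → lit (lookup T i) (x i))
  where
  lit : Maybe Bool → Bool → Bool
  lit nothing  _ = true
  lit (just b) v = eqB b v

evalDNF : ∀ {n} → List (Term n) → (Fin n → Bool) → Bool
evalDNF Ts x = any (λ T → evalTerm T x) Ts

varsOf : ∀ {n} → List (Term n) → VarSet n
varsOf {n} Ts = tabulate λ i → any (λ T → isJust (lookup T i)) Ts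

record FactoredDNF {n : ℕ} (r μ : ℕ) (h : (Fin n → Bool) → Bool) : Set where
  field
    head     : Term n
    tail     : List (Term n)
    tailLen  : length tail Data.Nat.≤ r
    disjoint : ∀ (i : Fin n) → isJust (lookup head i) ≡ true → lookup (varsOf tail) i ≡ false
    tailVars : countTrue (varsOf tail) Data.Nat.≤ μ
    repr     : ∀ x → h x ≡ (evalTerm head x ∧ evalDNF tail x)

module Submission where

-- Let (T*, S*) be the label of a cluster. The set of variables of T* ∪ S* only grows
-- and always contains the variables of every term absorbed so far, while T* shrinks to
-- the literals common to all of them. Hence any terms hs of the cluster factor as
-- T* ∧ ⋁ (T ∖ T*), with all tail variables in S*, and it remains to bound |S*|.
-- Let w₀ be the width of the cluster's first term; by the minimum-width choice it
-- bounds the width of every later term T′ from below. Each absorption adds at most 2K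
-- new literals, so |S*| + |T*| ≤ w₀ + 2Kj after j absorptions. Since the literals of T′
-- lie in T* ∩ T′, in S*, or among the new ones, |T* ∩ T′| ≥ w₀ − |S*| − 2K, so one
-- absorption adds at most 2K(j + 2) variables to S*. Then |S*| ≤ 2K(j + 1)² ≤ 2Ks².

open import Defs
open import Algebra.Bundles using (CommutativeMonoid)
open import Data.Bool using (Bool; true; false; _∧_; _∨_; not; if_then_else_)
open import Data.Bool.Properties
  using (∧-conicalˡ; ∧-conicalʳ; ∧-identityʳ; ∧-zeroʳ; ∧-distribˡ-∨; ∧-commutativeMonoid; T-≡; ¬-not)
  renaming (_≟_ to _≟ᵇ_)
open import Data.Bool.ListAction using (any)
open import Data.Fin using (zero; suc)
open import Data.Fin.Subset using (Subset; _∪_; _∩_; ∁; ⊥; _⊆_; ∣_∣) renaming (_∈_ to _∈ˢ_; _∉_ to _∉ˢ_)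
open import Data.Fin.Subset.Properties
  using (⊆-trans; p⊆p∪q; q⊆p∪q; x∈p∪q⁻; x∈p∩q⁺; x∈p∩q⁻; p∩q⊆p; x∈∁p⇒x∉p; p⊆q⇒∣p∣≤∣q∣)
open import Data.List using (List; []; _∷_; _++_; [_]; length)
import Data.List as List
open import Data.List.Membership.Propositional using (_∈_)
open import Data.List.Properties using (length-map)
open import Data.List.Relation.Unary.All using (All; []; _∷_) renaming (map to All-map; lookup to All-lookup)
open import Data.List.Relation.Unary.All.Properties using (++⁺; map⁺)
open import Data.List.Relation.Unary.Any using (here; there)
open import Data.List.Relation.Unary.Unique.Propositional using (Unique)
open import Data.List.Relation.Binary.Permutation.Propositional using (_↭_; ↭-refl; ↭-prep; ↭-swap; ↭-trans)
open import Data.List.Relation.Binary.Permutation.Propositional.Properties using (All-resp-↭; ↭-length)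
open import Data.Maybe using (Maybe; just; nothing)
open import Data.Nat using (ℕ; zero; suc; _+_; _*_; _≤_; _<_; _≤ᵇ_; _≡ᵇ_; z≤n; s≤s)
open import Data.Nat.Properties
open import Data.Nat.Tactic.RingSolver using (solve-∀)
open import Data.Product using (_×_; _,_; proj₂)
open import Data.Sum using (inj₁; inj₂)
open import Data.Vec using (Vec; []; _∷_; lookup; zipWith; replicate)
import Data.Vec as Vec
open import Data.Vec.Properties using (lookup-map; lookup∘tabulate; []=⇒lookup; lookup⇒[]=)
open import Data.Vec.Relation.Binary.Pointwise.Inductive using (Pointwise; []; _∷_)
import Data.Vec.Relation.Binary.Pointwise.Inductive as Pointwise
open import Function using (_∘_)
open import Function.Bundles using (Equivalence)
open import Relation.Binary.PropositionalEquality
  using (_≡_; refl; sym; trans; cong; cong₂; subst; subst₂; module ≡-Reasoning)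
open import Relation.Nullary using (Dec; contradiction)
open import Relation.Nullary.Decidable using (isYes; toWitness)

open import Algebra.Properties.CommutativeSemigroup +-commutativeSemigroup
  using () renaming (interchange to +-interchange)
open import Algebra.Properties.CommutativeSemigroup (CommutativeMonoid.commutativeSemigroup ∧-commutativeMonoid)
  using () renaming (interchange to ∧-interchange)
open Equivalence using (from)

private
  variable
    n : ℕ

-- A cell (a, b, σ) is one coordinate (T*ᵢ, T′ᵢ, S*ᵢ) of a clustering step; facts about
-- a single cell are decided by evaluating them on all 18 cells.

meet : Maybe Bool → Maybe Bool → Maybe Bool
meet a b = if eqM a b then a else nothing

toℕ : Bool → ℕ
toℕ false = 0
toℕ true  = 1

allBool : (Bool → Bool) → Bool
allBool p = p false ∧ p true

allMaybeBool : (Maybe Bool → Bool) → Bool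
allMaybeBool p = p nothing ∧ allBool (p ∘ just)

allBool-sound : ∀ (p : Bool → Bool) → allBool p ≡ true → ∀ b → p b ≡ true
allBool-sound p ok false = ∧-conicalˡ (p false) _ ok
allBool-sound p ok true  = ∧-conicalʳ (p false) _ ok

allMaybeBool-sound : ∀ (p : Maybe Bool → Bool) → allMaybeBool p ≡ true → ∀ a → p a ≡ true
allMaybeBool-sound p ok nothing  = ∧-conicalˡ (p nothing) _ ok
allMaybeBool-sound p ok (just b) = allBool-sound (p ∘ just) (∧-conicalʳ (p nothing) _ ok) b

allCells : (Maybe Bool → Maybe Bool → Bool → Bool) → Bool
allCells p = allMaybeBool λ a → allMaybeBool λ b → allBool (p a b)

decideCells : ∀ {P : Maybe Bool → Maybe Bool → Bool → Set} (P? : ∀ a b σ → Dec (P a b σ))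
  → allCells (λ a b σ → isYes (P? a b σ)) ≡ true → ∀ a b σ → P a b σ
decideCells P? ok a b σ = toWitness {a? = P? a b σ} (T-≡ .from holds)
  where
  p = λ a b σ → isYes (P? a b σ)
  holds : p a b σ ≡ true
  holds = allBool-sound (p a b) (allMaybeBool-sound (allBool ∘ p a)
            (allMaybeBool-sound (λ a → allMaybeBool (allBool ∘ p a)) ok a) b) σ

data _⊑_ : Maybe Bool → Maybe Bool → Set where
  nothing⊑ : ∀ {b} → nothing ⊑ b
  just⊑    : ∀ {x} → just x ⊑ just x

⊑-refl : ∀ {a} → a ⊑ a
⊑-refl {nothing} = nothing⊑
⊑-refl {just _}  = just⊑

⊑-trans : ∀ {a b c} → a ⊑ b → b ⊑ c → a ⊑ c
⊑-trans nothing⊑ _     = nothing⊑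
⊑-trans just⊑    just⊑ = just⊑

eqM-sound : ∀ a b → eqM a b ≡ true → a ≡ b
eqM-sound nothing      nothing      _ = refl
eqM-sound (just true)  (just true)  _ = refl
eqM-sound (just false) (just false) _ = refl
eqM-sound nothing      (just _)     ()
eqM-sound (just _)     nothing      ()
eqM-sound (just true)  (just false) ()
eqM-sound (just false) (just true)  ()

meet-⊑ˡ : ∀ a b → meet a b ⊑ a
meet-⊑ˡ a b with eqM a b
... | true  = ⊑-refl
... | false = nothing⊑

meet-⊑ʳ : ∀ a b → meet a b ⊑ b
meet-⊑ʳ a b with eqM a b in a≟b
... | true rewrite eqM-sound a b a≟b = ⊑-refl
... | false = nothing⊑

newLit : Maybe Bool → Bool → Maybe Bool → Bool
newLit a σ b = isJust b ∧ not (eqM b a) ∧ not σ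

budget-cell : ∀ a b σ →
  toℕ (σ ∨ not (eqM a b)) + toℕ (isJust (meet a b)) ≤ toℕ σ + toℕ (isJust a) + toℕ (newLit a σ b)
budget-cell = decideCells (λ _ _ _ → _ ≤? _) refl

width-cell : ∀ a b σ → toℕ (isJust b) ≤ toℕ (isJust (meet a b)) + toℕ σ + toℕ (newLit a σ b)
width-cell = decideCells (λ _ _ _ → _ ≤? _) refl

covered-cell : ∀ a b σ → isJust (meet a b) ∨ (σ ∨ not (eqM a b)) ≡ (isJust a ∨ σ) ∨ isJust b
covered-cell = decideCells (λ _ _ _ → _ ≟ᵇ _) refl

vars : Term n → Subset n
vars = Vec.map isJust

infix 4 _⊆ᵗ_ _⊑_

_⊆ᵗ_ : Term n → Term n → Set
_⊆ᵗ_ = Pointwise _⊑_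

⊆ᵗ-refl : {A : Term n} → A ⊆ᵗ A
⊆ᵗ-refl = Pointwise.refl ⊑-refl

⊆ᵗ-trans : {A B C : Term n} → A ⊆ᵗ B → B ⊆ᵗ C → A ⊆ᵗ C
⊆ᵗ-trans = Pointwise.trans ⊑-trans

∩ᵗ-⊆ᵗˡ : ∀ (A B : Term n) → A ∩ᵗ B ⊆ᵗ A
∩ᵗ-⊆ᵗˡ []      []      = []
∩ᵗ-⊆ᵗˡ (a ∷ A) (b ∷ B) = meet-⊑ˡ a b ∷ ∩ᵗ-⊆ᵗˡ A B

∩ᵗ-⊆ᵗʳ : ∀ (A B : Term n) → A ∩ᵗ B ⊆ᵗ B
∩ᵗ-⊆ᵗʳ []      []      = []
∩ᵗ-⊆ᵗʳ (a ∷ A) (b ∷ B) = meet-⊑ʳ a b ∷ ∩ᵗ-⊆ᵗʳ A B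

covered : Term n → Subset n → Subset n
covered T S = vars T ∪ S

covered-step : ∀ (A : Term n) S B → covered (A ∩ᵗ B) (S ∪ symDiffVars A B) ≡ covered A S ∪ vars B
covered-step []      []      []      = refl
covered-step (a ∷ A) (σ ∷ S) (b ∷ B) = cong₂ _∷_ (covered-cell a b σ) (covered-step A S B)

countTrue-∷ : ∀ b (bs : Vec Bool n) → countTrue (b ∷ bs) ≡ toℕ b + countTrue bs
countTrue-∷ false _ = refl
countTrue-∷ true  _ = refl

countTrue-⊥ : ∀ n → countTrue (⊥ {n}) ≡ 0
countTrue-⊥ zero    = refl
countTrue-⊥ (suc n) = countTrue-⊥ n

countTrue-mono : {p q : Subset n} → p ⊆ q → countTrue p ≤ countTrue q
countTrue-mono {p = p} {q} p⊆q = subst₂ _≤_ (sym (countTrue≡∣∣ p)) (sym (countTrue≡∣∣ q)) (p⊆q⇒∣p∣≤∣q∣ p⊆q)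
  where
  countTrue≡∣∣ : ∀ {n} (p : Subset n) → countTrue p ≡ ∣ p ∣
  countTrue≡∣∣ []          = refl
  countTrue≡∣∣ (false ∷ p) = countTrue≡∣∣ p
  countTrue≡∣∣ (true ∷ p)  = cong suc (countTrue≡∣∣ p)

+-interchange₃ : ∀ a b c d e f → (a + b + c) + (d + e + f) ≡ (a + d) + (b + e) + (c + f)
+-interchange₃ a b c d e f =
  trans (+-interchange (a + b) c (d + e) f) (cong (_+ (c + f)) (+-interchange a b d e))

countTrue-∷-mono₂₃ : ∀ x₁ x₂ y₁ y₂ y₃ {X₁ X₂ Y₁ Y₂ Y₃ : Vec Bool n}
  → toℕ x₁ + toℕ x₂ ≤ toℕ y₁ + toℕ y₂ + toℕ y₃
  → countTrue X₁ + countTrue X₂ ≤ countTrue Y₁ + countTrue Y₂ + countTrue Y₃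
  → countTrue (x₁ ∷ X₁) + countTrue (x₂ ∷ X₂)
    ≤ countTrue (y₁ ∷ Y₁) + countTrue (y₂ ∷ Y₂) + countTrue (y₃ ∷ Y₃)
countTrue-∷-mono₂₃ x₁ x₂ y₁ y₂ y₃ {X₁} {X₂} {Y₁} {Y₂} {Y₃} heads tails
  rewrite countTrue-∷ x₁ X₁ | countTrue-∷ x₂ X₂ | countTrue-∷ y₁ Y₁ | countTrue-∷ y₂ Y₂ | countTrue-∷ y₃ Y₃
  = subst₂ _≤_ (+-interchange (toℕ x₁) (toℕ x₂) (countTrue X₁) (countTrue X₂))
      (+-interchange₃ (toℕ y₁) (toℕ y₂) (toℕ y₃) (countTrue Y₁) (countTrue Y₂) (countTrue Y₃))
      (+-mono-≤ heads tails)

countTrue-∷-mono₁₃ : ∀ x y₁ y₂ y₃ {X Y₁ Y₂ Y₃ : Vec Bool n}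
  → toℕ x ≤ toℕ y₁ + toℕ y₂ + toℕ y₃
  → countTrue X ≤ countTrue Y₁ + countTrue Y₂ + countTrue Y₃
  → countTrue (x ∷ X) ≤ countTrue (y₁ ∷ Y₁) + countTrue (y₂ ∷ Y₂) + countTrue (y₃ ∷ Y₃)
countTrue-∷-mono₁₃ x y₁ y₂ y₃ {X} {Y₁} {Y₂} {Y₃} heads tails
  rewrite countTrue-∷ x X | countTrue-∷ y₁ Y₁ | countTrue-∷ y₂ Y₂ | countTrue-∷ y₃ Y₃
  = subst (toℕ x + countTrue X ≤_)
      (+-interchange₃ (toℕ y₁) (toℕ y₂) (toℕ y₃) (countTrue Y₁) (countTrue Y₂) (countTrue Y₃))
      (+-mono-≤ heads tails)

budget-count : ∀ (A : Term n) S B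
  → countTrue (S ∪ symDiffVars A B) + width (A ∩ᵗ B) ≤ countTrue S + width A + newLits A S B
budget-count []      []      []      = z≤n
budget-count (a ∷ A) (σ ∷ S) (b ∷ B) =
  countTrue-∷-mono₂₃ (σ ∨ not (eqM a b)) (isJust (meet a b)) σ (isJust a) (newLit a σ b)
    (budget-cell a b σ) (budget-count A S B)

width-count : ∀ (A : Term n) S B → width B ≤ width (A ∩ᵗ B) + countTrue S + newLits A S B
width-count []      []      []      = z≤n
width-count (a ∷ A) (σ ∷ S) (b ∷ B) =
  countTrue-∷-mono₁₃ (isJust b) (isJust (meet a b)) σ (newLit a σ b) (width-cell a b σ) (width-count A S B)

_∖ᶜ_ : Maybe Bool → Maybe Bool → Maybe Bool
t ∖ᶜ h = if isJust h then nothing else t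

_∖ᵗ_ : Term n → Term n → Term n
_∖ᵗ_ = zipWith _∖ᶜ_

literal : Maybe Bool → Bool → Bool
literal nothing  _ = true
literal (just b) v = eqB b v

evalTerm-∷ : ∀ t (T : Term n) x → evalTerm (t ∷ T) x ≡ literal t (x zero) ∧ evalTerm T (x ∘ suc)
evalTerm-∷ nothing  _ _ = refl
evalTerm-∷ (just _) _ _ = refl

literal-∖ᶜ : ∀ {h t} → h ⊑ t → ∀ v → literal t v ≡ literal h v ∧ literal (t ∖ᶜ h) v
literal-∖ᶜ nothing⊑     v = refl
literal-∖ᶜ (just⊑ {x}) v = sym (∧-identityʳ (eqB x v))

evalTerm-∖ᵗ : ∀ {H T : Term n} → H ⊆ᵗ T → ∀ x → evalTerm T x ≡ evalTerm H x ∧ evalTerm (T ∖ᵗ H) x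
evalTerm-∖ᵗ [] x = refl
evalTerm-∖ᵗ {H = h ∷ H} {t ∷ T} (h⊑t ∷ H⊆T) x = begin
  evalTerm (t ∷ T) x
    ≡⟨ evalTerm-∷ t T x ⟩
  literal t x₀ ∧ evalTerm T x⁺
    ≡⟨ cong₂ _∧_ (literal-∖ᶜ h⊑t x₀) (evalTerm-∖ᵗ H⊆T x⁺) ⟩
  (literal h x₀ ∧ literal (t ∖ᶜ h) x₀) ∧ (evalTerm H x⁺ ∧ evalTerm (T ∖ᵗ H) x⁺)
    ≡⟨ ∧-interchange (literal h x₀) _ (evalTerm H x⁺) _ ⟩
  (literal h x₀ ∧ evalTerm H x⁺) ∧ (literal (t ∖ᶜ h) x₀ ∧ evalTerm (T ∖ᵗ H) x⁺)
    ≡⟨ sym (cong₂ _∧_ (evalTerm-∷ h H x) (evalTerm-∷ (t ∖ᶜ h) (T ∖ᵗ H) x)) ⟩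
  evalTerm (h ∷ H) x ∧ evalTerm ((t ∷ T) ∖ᵗ (h ∷ H)) x ∎
  where
  open ≡-Reasoning
  x₀ = x zero
  x⁺ = x ∘ suc

evalDNF-∖ᵗ : ∀ {H : Term n} {Ts} → All (H ⊆ᵗ_) Ts
  → ∀ x → evalDNF Ts x ≡ evalTerm H x ∧ evalDNF (List.map (_∖ᵗ H) Ts) x
evalDNF-∖ᵗ {H = H} []             x = sym (∧-zeroʳ (evalTerm H x))
evalDNF-∖ᵗ {H = H} (H⊆T ∷ H⊆Ts) x =
  trans (cong₂ _∨_ (evalTerm-∖ᵗ H⊆T x) (evalDNF-∖ᵗ H⊆Ts x)) (sym (∧-distribˡ-∨ (evalTerm H x) _ _))

vars-∖ᵗ : ∀ (T H : Term n) → vars (T ∖ᵗ H) ≡ vars T ∩ ∁ (vars H)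
vars-∖ᵗ []      []      = refl
vars-∖ᵗ (t ∷ T) (h ∷ H) = cong₂ _∷_ (cell h) (vars-∖ᵗ T H)
  where
  cell : ∀ h → isJust (t ∖ᶜ h) ≡ isJust t ∧ not (isJust h)
  cell nothing  = sym (∧-identityʳ (isJust t))
  cell (just _) = sym (∧-zeroʳ (isJust t))

∈-vars : ∀ {T : Term n} {i} → isJust (lookup T i) ≡ true → i ∈ˢ vars T
∈-vars {T = T} {i} i∈T = lookup⇒[]= i (vars T) (trans (lookup-map i isJust T) i∈T)

varsOf-⊆ : ∀ {U : Subset n} {Ts} → All (λ T → vars T ⊆ U) Ts → varsOf Ts ⊆ U
varsOf-⊆ {U = U} Ts⊆U {i} i∈Ts = go Ts⊆U (trans (sym (lookup∘tabulate _ i)) ([]=⇒lookup i∈Ts))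
  where
  go : ∀ {Ts} → All (λ T → vars T ⊆ U) Ts → any (λ T → isJust (lookup T i)) Ts ≡ true → i ∈ˢ U
  go {T ∷ _} (T⊆U ∷ Ts⊆U) i∈ with isJust (lookup T i) in i∈T
  ... | true  = T⊆U (∈-vars i∈T)
  ... | false = go Ts⊆U i∈

⊆∪⇒∩∁⊆ : ∀ {p q r : Subset n} → p ⊆ q ∪ r → p ∩ ∁ q ⊆ r ∩ ∁ q
⊆∪⇒∩∁⊆ {p = p} {q} {r} p⊆q∪r x∈ with x∈p∩q⁻ p (∁ q) x∈
... | x∈p , x∈∁q with x∈p∪q⁻ q r (p⊆q∪r x∈p)
...   | inj₁ x∈q = contradiction x∈q (x∈∁p⇒x∉p x∈∁q)
...   | inj₂ x∈r = x∈p∩q⁺ (x∈r , x∈∁q)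

record IsLabel (C : List (Term n)) (T* : Term n) (S* : Subset n) : Set where
  field
    ⊆-members : All (T* ⊆ᵗ_) C
    covers    : All (λ T → vars T ⊆ covered T* S*) C

open IsLabel

factoredDNF : ∀ {μ} {hs : List (Term n)} {H S} → IsLabel hs H S → countTrue S ≤ μ
  → FactoredDNF (length hs) μ (evalDNF hs)
factoredDNF {hs = hs} {H} {S} label S≤μ = record
  { head     = H
  ; tail     = List.map (_∖ᵗ H) hs
  ; tailLen  = ≤-reflexive (length-map (_∖ᵗ H) hs)
  ; disjoint = λ i i∈H → ¬-not λ i∈tail → tail∌H (tail⊆ (lookup⇒[]= i _ i∈tail)) (∈-vars i∈H)
  ; tailVars = ≤-trans (countTrue-mono (⊆-trans tail⊆ (p∩q⊆p S _))) S≤μ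
  ; repr     = evalDNF-∖ᵗ (⊆-members label)
  }
  where
  tail∌H : ∀ {i} → i ∈ˢ S ∩ ∁ (vars H) → i ∉ˢ vars H
  tail∌H i∈ = x∈∁p⇒x∉p (proj₂ (x∈p∩q⁻ S _ i∈))
  tail⊆ : varsOf (List.map (_∖ᵗ H) hs) ⊆ S ∩ ∁ (vars H)
  tail⊆ = varsOf-⊆ (map⁺ (All-map (λ {T} → ∖ᵗ-⊆ T) (covers label)))
    where
    ∖ᵗ-⊆ : ∀ T → vars T ⊆ covered H S → vars (T ∖ᵗ H) ⊆ S ∩ ∁ (vars H)
    ∖ᵗ-⊆ T T⊆ = subst (_⊆ S ∩ ∁ (vars H)) (sym (vars-∖ᵗ T H)) (⊆∪⇒∩∁⊆ {p = vars T} T⊆)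

IsLabel-step : ∀ {C A S} (B : Term n) → IsLabel C A S → IsLabel (C ++ [ B ]) (A ∩ᵗ B) (S ∪ symDiffVars A B)
IsLabel-step {C = C} {A} {S} B label = record
  { ⊆-members = ++⁺ (All-map (⊆ᵗ-trans (∩ᵗ-⊆ᵗˡ A B)) (⊆-members label)) (∩ᵗ-⊆ᵗʳ A B ∷ [])
  ; covers    = subst (λ U → All (λ T → vars T ⊆ U) (C ++ [ B ])) (sym (covered-step A S B))
                  (++⁺ (All-map widen (covers label)) (q⊆p∪q (covered A S) (vars B) ∷ []))
  }
  where
  widen : ∀ {T} → vars T ⊆ covered A S → vars T ⊆ covered A S ∪ vars B
  widen T⊆ = ⊆-trans T⊆ (p⊆p∪q (vars B))

IsLabel-⊆ : ∀ {C hs : List (Term n)} {T S} → IsLabel C T S → All (_∈ C) hs → IsLabel hs T S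
IsLabel-⊆ label hs⊆C = record
  { ⊆-members = All-map (All-lookup (⊆-members label)) hs⊆C
  ; covers    = All-map (All-lookup (covers label)) hs⊆C
  }

record Labelled (μ : ℕ) (C : List (Term n)) : Set where
  field
    T*      : Term n
    S*      : Subset n
    isLabel : IsLabel C T* S*
    bounded : countTrue S* ≤ μ

-- After j absorptions into a cluster whose first term has width w₀, with at most d new
-- literals allowed per absorption.
record Invariant (d w₀ j : ℕ) (C : List (Term n)) (T* : Term n) (S* : Subset n) : Set where
  field
    isLabel : IsLabel C T* S*
    budget  : countTrue S* + width T* ≤ w₀ + d * j
    spread  : countTrue S* ≤ d * (suc j * suc j)

initial : ∀ d (T₀ : Term n) → Invariant d (width T₀) 0 [ T₀ ] T₀ ⊥
initial {n} d T₀ = record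
  { isLabel = record { ⊆-members = ⊆ᵗ-refl ∷ [] ; covers = p⊆p∪q ⊥ ∷ [] }
  ; budget  = subst (λ m → m + width T₀ ≤ width T₀ + d * 0) (sym (countTrue-⊥ n)) (m≤m+n (width T₀) (d * 0))
  ; spread  = subst (_≤ d * 1) (sym (countTrue-⊥ n)) z≤n
  }

budget-arith : ∀ {a t a′ t′ e w d j} → a′ + t′ ≤ a + t + e → a + t ≤ w + d * j → e ≤ d
  → a′ + t′ ≤ w + d * suc j
budget-arith {a} {t} {a′} {t′} {e} {w} {d} {j} step budget e≤d = begin
  a′ + t′         ≤⟨ step ⟩
  a + t + e       ≤⟨ +-mono-≤ budget e≤d ⟩
  w + d * j + d   ≡⟨ +-assoc w (d * j) d ⟩
  w + (d * j + d) ≡⟨ cong (w +_) (trans (+-comm (d * j) d) (sym (*-suc d j))) ⟩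
  w + d * suc j   ∎
  where open ≤-Reasoning

spread-arith : ∀ {a t a′ t′ e b w d j} → a′ + t′ ≤ a + t + e → b ≤ t′ + a + e → w ≤ b
  → a + t ≤ w + d * j → e ≤ d → a ≤ d * (suc j * suc j)
  → a′ ≤ d * (suc (suc j) * suc (suc j))
spread-arith {a} {t} {a′} {t′} {e} {b} {w} {d} {j} step cover w≤b budget e≤d spread = begin
  a′                                                  ≤⟨ +-cancelʳ-≤ w a′ _ a′+w≤ ⟩
  d * (suc j * suc j) + d * suc (suc j)               ≤⟨ m≤m+n _ (d * suc j) ⟩
  d * (suc j * suc j) + d * suc (suc j) + d * suc j   ≡⟨ next-square d j ⟩
  d * (suc (suc j) * suc (suc j))                     ∎
  where
  open ≤-Reasoning
  next-square : ∀ d j → d * (suc j * suc j) + d * suc (suc j) + d * suc j ≡ d * (suc (suc j) * suc (suc j))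
  next-square = solve-∀
  a′+w≤ : a′ + w ≤ d * (suc j * suc j) + d * suc (suc j) + w
  a′+w≤ = begin
    a′ + w                                      ≤⟨ +-monoʳ-≤ a′ (≤-trans w≤b cover) ⟩
    a′ + (t′ + a + e)                           ≡⟨ shuffle₁ a′ t′ a e ⟩
    (a′ + t′) + (a + e)                         ≤⟨ +-monoˡ-≤ (a + e) step ⟩
    (a + t + e) + (a + e)                       ≡⟨ shuffle₂ a t e ⟩
    (a + t) + (a + e + e)                       ≤⟨ +-mono-≤ budget (+-mono-≤ (+-mono-≤ spread e≤d) e≤d) ⟩
    (w + d * j) + (d * (suc j * suc j) + d + d) ≡⟨ shuffle₃ w d j ⟩
    d * (suc j * suc j) + d * suc (suc j) + w   ∎
    where
    shuffle₁ : ∀ a′ t′ a e → a′ + (t′ + a + e) ≡ (a′ + t′) + (a + e)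
    shuffle₁ = solve-∀
    shuffle₂ : ∀ a t e → (a + t + e) + (a + e) ≡ (a + t) + (a + e + e)
    shuffle₂ = solve-∀
    shuffle₃ : ∀ w d j
      → (w + d * j) + (d * (suc j * suc j) + d + d) ≡ d * (suc j * suc j) + d * suc (suc j) + w
    shuffle₃ = solve-∀

invariant-step : ∀ {d w₀ j C A S} (B : Term n) → Invariant d w₀ j C A S → w₀ ≤ width B → newLits A S B ≤ d
  → Invariant d w₀ (suc j) (C ++ [ B ]) (A ∩ᵗ B) (S ∪ symDiffVars A B)
invariant-step {A = A} {S} B inv w₀≤B new≤d = record
  { isLabel = IsLabel-step B isLabel
  ; budget  = budget-arith {a = countTrue S} {width A} {countTrue S′} {width A′}
                (budget-count A S B) budget new≤d
  ; spread  = spread-arith {a = countTrue S} {width A} {countTrue S′} {width A′}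
                (budget-count A S B) (width-count A S B) w₀≤B budget new≤d spread
  }
  where
  open Invariant inv
  A′ = A ∩ᵗ B
  S′ = S ∪ symDiffVars A B

Invariant⇒Labelled : ∀ {d w₀ j s} {C : List (Term n)} {T* S*} → Invariant d w₀ j C T* S* → suc j ≤ s
  → Labelled (d * (s * s)) C
Invariant⇒Labelled {d = d} inv j<s = record
  { isLabel = isLabel
  ; bounded = ≤-trans spread (*-monoʳ-≤ d (*-mono-≤ j<s j<s))
  }
  where open Invariant inv

extractFirst-↭ : ∀ {A : Set} (p : A → Bool) xs {y ys} → extractFirst p xs ≡ just (y , ys)
  → p y ≡ true × xs ↭ y ∷ ys
extractFirst-↭ p [] ()
extractFirst-↭ p (x ∷ xs) found with p x in px
extractFirst-↭ p (x ∷ xs) refl | true = px , ↭-refl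
extractFirst-↭ p (x ∷ xs) found | false with extractFirst p xs in found′
extractFirst-↭ p (x ∷ xs) ()   | false | nothing
extractFirst-↭ p (x ∷ xs) refl | false | just (y , ys) with extractFirst-↭ p xs found′
... | py , xs↭ = py , ↭-trans (↭-prep x xs↭) (↭-swap x y ↭-refl)

grow-length : ∀ K fuel {C : List (Term n)} {T* S* L C′ L′′} → grow K fuel C T* S* L ≡ (C′ , L′′)
  → length L′′ ≤ length L
grow-length K zero refl = ≤-refl
grow-length K (suc fuel) {T* = T*} {S*} {L} grown
  with extractFirst (λ B → newLits T* S* B ≤ᵇ (2 * K)) L in found
grow-length K (suc fuel) refl | nothing = ≤-refl
grow-length K (suc fuel) {L = L} grown | just (B , L′) with extractFirst-↭ _ L found
... | _ , L↭ = ≤-trans (grow-length K fuel grown) (≤-trans (n≤1+n _) (≤-reflexive (sym (↭-length L↭))))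

grow-invariant : ∀ K {s w₀} fuel {j} {C : List (Term n)} {T* S* L C′ L′′}
  → j + fuel < s → All (λ T → w₀ ≤ width T) L → Invariant (2 * K) w₀ j C T* S*
  → grow K fuel C T* S* L ≡ (C′ , L′′) → Labelled (2 * K * (s * s)) C′
grow-invariant K zero {j} j<s _ inv refl = Invariant⇒Labelled inv (≤-trans (s≤s (m≤m+n j 0)) j<s)
grow-invariant K (suc fuel) {j} {T* = T*} {S*} {L} j<s wide inv grown
  with extractFirst (λ B → newLits T* S* B ≤ᵇ (2 * K)) L in found
grow-invariant K (suc fuel) {j} j<s wide inv refl | nothing =
  Invariant⇒Labelled inv (≤-trans (s≤s (m≤m+n j (suc fuel))) j<s)
grow-invariant K {s} (suc fuel) {j} {L = L} j<s wide inv grown | just (B , L′)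
  with extractFirst-↭ _ L found
... | fits , L↭ with All-resp-↭ L↭ wide
... | w₀≤B ∷ wide′ = grow-invariant K fuel (subst (_< s) (+-suc j fuel) j<s) wide′
                       (invariant-step B inv w₀≤B (≤ᵇ⇒≤ _ _ (T-≡ .from fits))) grown

minWidth-≤ : ∀ (L : List (Term n)) → All (λ T → minWidth L ≤ width T) L
minWidth-≤ []                = []
minWidth-≤ (T ∷ [])          = ≤-refl ∷ []
minWidth-≤ (T ∷ L@(_ ∷ _)) = m⊓n≤m _ _ ∷ All-map (≤-trans (m⊓n≤n _ _)) (minWidth-≤ L)

clusterLoop-labelled : ∀ K {s} fuel (L : List (Term n)) → length L ≤ s
  → ∀ {C} → C ∈ clusterLoop K fuel L → Labelled (2 * K * (s * s)) C
clusterLoop-labelled K zero L _ ()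
clusterLoop-labelled K (suc fuel) L L≤s C∈ with extractFirst (λ T → width T ≡ᵇ minWidth L) L in found
clusterLoop-labelled K (suc fuel) L L≤s () | nothing
clusterLoop-labelled {n} K (suc fuel) L L≤s C∈ | just (T₀ , L′) with extractFirst-↭ _ L found
... | minimal , L↭ with grow K (length L′) (T₀ ∷ []) T₀ (replicate n false) L′ in grown
... | (C₁ , L′′) with C∈
... | here refl = grow-invariant K (length L′) L′<s wide (initial (2 * K) T₀) grown
  where
  L′<s : length L′ < _
  L′<s = subst (_≤ _) (↭-length L↭) L≤s
  wide : All (λ T → width T₀ ≤ width T) L′
  wide with All-resp-↭ L↭ (minWidth-≤ L)
  ... | _ ∷ rest = All-map (≤-trans (≤-reflexive (≡ᵇ⇒≡ _ _ (T-≡ .from minimal)))) rest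
... | there C∈′ = clusterLoop-labelled K fuel L′′ L′′≤s C∈′
  where
  L′′≤s : length L′′ ≤ _
  L′′≤s = ≤-trans (grow-length K (length L′) grown) (≤-trans (n≤1+n _) (subst (_≤ _) (↭-length L↭) L≤s))

2Ks²≤16s²K : ∀ K s → 2 * K * (s * s) ≤ 16 * (s * s) * K
2Ks²≤16s²K K s = subst₂ _≤_ (lhs K s) (rhs K s) (*-monoˡ-≤ (s * s * K) {2} {16} (s≤s (s≤s z≤n)))
  where
  lhs : ∀ K s → 2 * (s * s * K) ≡ 2 * K * (s * s)
  lhs = solve-∀
  rhs : ∀ K s → 16 * (s * s * K) ≡ 16 * (s * s) * K
  rhs = solve-∀

claim19 : (n s K k : ℕ) (f : List (Term n)) → length f ≡ s → Unique f → 1 ≤ K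
    → (C : List (Term n)) → C ∈ Clustering f K
    → (hs : List (Term n)) → length hs ≡ k → Unique hs → All (_∈ C) hs
    → FactoredDNF k (16 * (s * s) * K) (evalDNF hs)
claim19 n s K k f refl _ _ C C∈ hs refl _ hs⊆C =
  factoredDNF (IsLabel-⊆ isLabel hs⊆C) (≤-trans bounded (2Ks²≤16s²K K s))
  where open Labelled (clusterLoop-labelled K (length f) f ≤-refl C∈)
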